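{- Let $A$ be a totally ordered alphabet and let $\ell_1,\dots,\ell_n$, with $n\ge2$, be Lyndon words over $A$ such that $\ell_1^\omega\ge\ell_2^\omega\ge\cdots\ge\ell_n^\omega$. Then $\ell_1^\omega\ge(\ell_2\cdots\ell_n)^\omega$.
   Context: The order $<$ on infinite words is the lexicographical order induced by the order of $A$. For a nonempty finite word $x$, $x^\omega=xxx\cdots$. A nonempty word $w$ is a Lyndon word if for every factorization $w=uv$ with $u,v$ nonempty one has $w<v$ lexicographically. -}

module Defs where

open import Level using (Level)
open import Data.Nat using (ℕ; _<_; _%_; NonZero)
open import Data.Nat.DivMod using (m%n<n)
open import Data.Empty using (⊥)
open import Data.Unit using (⊤)
open import Data.Fin using (Fin; fromℕ<)
open import Data.List using (List; []; _∷_; _++_; length; concat; lookup)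
open import Data.List.NonEmpty using (List⁺; _∷_; toList; _⁺++_)
open import Data.Product using (Σ; ∃; ∃-syntax; _×_; _,_)
open import Data.Sum using (_⊎_)
open import Relation.Binary.PropositionalEquality using (_≡_)
open import Relation.Binary.Bundles using (StrictTotalOrder)

module Words {c ℓ₁ ℓ₂ : Level} (O : StrictTotalOrder c ℓ₁ ℓ₂) where
  open StrictTotalOrder O renaming (Carrier to A; _<_ to _≺_)

  _<ₗ_ : List A → List A → Set _
  x <ₗ y = (∃[ s ] (∃[ b ] y ≡ x ++ (b ∷ s)))
         ⊎ (∃[ p ] ∃[ a ] ∃[ b ] ∃[ x' ] ∃[ y' ]
             (x ≡ p ++ (a ∷ x')) × (y ≡ p ++ (b ∷ y')) × (a ≺ b))

  NonEmptyWord : List A → Set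
  NonEmptyWord [] = ⊥
  NonEmptyWord (_ ∷ _) = ⊤

  Lyndon : List⁺ A → Set _
  Lyndon w = ∀ (u v : List A) → NonEmptyWord u → NonEmptyWord v →
             toList w ≡ u ++ v → toList w <ₗ v

  Stream : Set c
  Stream = ℕ → A

  _^ω : List⁺ A → Stream
  ((h ∷ t) ^ω) i = lookup (h ∷ t) (fromℕ< (m%n<n i (length (h ∷ t))))

  _<ω_ : Stream → Stream → Set _
  u <ω v = ∃[ k ] ((∀ i → i < k → u i ≡ v i) × (u k ≺ v k))

  _≥ω_ : Stream → Stream → Set _
  u ≥ω v = (v <ω u) ⊎ (∀ i → u i ≡ v i)

-- For arbitrary nonempty words u, v and an infinite word x one has
-- x ≥ v^ω ⇔ x ≥ v x.  Hence u^ω ≥ v^ω gives u^ω = u u^ω ≥ u v u^ω, i.e.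
-- u^ω ≥ (uv)^ω.  Along the chain ℓ₂^ω ≥ ℓ₃^ω ≥ ⋯ ≥ ℓₙ^ω this yields
-- ℓ₂^ω ≥ (ℓ₂⋯ℓₙ)^ω by induction on n, and ℓ₁^ω ≥ ℓ₂^ω finishes.
module Submission where

open import Defs
open import Level using (Level)
open import Data.List using (List; []; _∷_; concat; map)
open import Data.List.NonEmpty using (List⁺; _⁺++_; toList)
open import Data.List.Relation.Unary.All using (All)
open import Data.List.Relation.Unary.Linked using (Linked; _∷_)
open import Relation.Binary.Bundles using (StrictTotalOrder)

open import Data.Nat using (ℕ; zero; suc; _+_; _%_; _<_; _≤_; z≤n; s≤s; _<?_)
open import Data.Nat.Properties
  using (<-cmp; ≮⇒≥; ≤-refl; ≤-trans; <-trans; <⇒≤; m≤n+m; +-comm)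
open import Data.Nat.DivMod using ([m+n]%n≡m%n; m<n⇒m%n≡m)
open import Data.Nat.Induction using (<-wellFounded)
open import Data.Fin using (fromℕ<)
open import Data.Fin.Properties using (fromℕ<-cong)
open import Data.List.Properties using (++-identityʳ)
open import Data.Product using (∃-syntax; _×_; _,_)
open import Data.Sum using (inj₁; inj₂)
open import Data.Empty using (⊥-elim)
open import Induction.WellFounded using (Acc; acc)
open import Relation.Nullary using (yes; no)
open import Relation.Binary using (tri<; tri≈; tri>)
open import Relation.Binary.PropositionalEquality
  using (_≡_; refl; sym; trans; cong; subst; subst₂; module ≡-Reasoning)
import Data.List as List
import Data.List.NonEmpty as List⁺

module LexicographicPowers {c ℓ₁ ℓ₂ : Level} (O : StrictTotalOrder c ℓ₁ ℓ₂) where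
  open StrictTotalOrder O using (irrefl; module Eq)
    renaming (Carrier to A; _<_ to _≺_; trans to ≺-trans)
  open Words O

  infixr 5 _∷ˢ_ _++ˢ_ _^_++ˢ_
  infix 4 _≈ˢ_ _≡[<_]_ _<ω[_]_

  _∷ˢ_ : A → Stream → Stream
  (a ∷ˢ s) zero    = a
  (a ∷ˢ s) (suc i) = s i

  _++ˢ_ : List A → Stream → Stream
  []      ++ˢ s = s
  (a ∷ l) ++ˢ s = a ∷ˢ (l ++ˢ s)

  _^_++ˢ_ : List A → ℕ → Stream → Stream
  l ^ zero  ++ˢ s = s
  l ^ suc n ++ˢ s = l ++ˢ (l ^ n ++ˢ s)

  drop : ℕ → Stream → Stream
  drop m s i = s (m + i)

  _≈ˢ_ : Stream → Stream → Set c
  s ≈ˢ t = ∀ i → s i ≡ t i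

  _≡[<_]_ : Stream → ℕ → Stream → Set c
  s ≡[< n ] t = ∀ i → i < n → s i ≡ t i

  _<ω[_]_ : Stream → ℕ → Stream → Set _
  s <ω[ k ] t = s ≡[< k ] t × s k ≺ t k

  ≈ˢ-sym : ∀ {s t} → s ≈ˢ t → t ≈ˢ s
  ≈ˢ-sym s≈t i = sym (s≈t i)

  ≈ˢ-trans : ∀ {s t r} → s ≈ˢ t → t ≈ˢ r → s ≈ˢ r
  ≈ˢ-trans s≈t t≈r i = trans (s≈t i) (t≈r i)

  <ω[]-resp-≈ˢ : ∀ {s s′ t t′ k} → s ≈ˢ s′ → t ≈ˢ t′ → s <ω[ k ] t → s′ <ω[ k ] t′
  <ω[]-resp-≈ˢ {k = k} s≈s′ t≈t′ (agree , s<t) =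
    (λ i i<k → trans (sym (s≈s′ i)) (trans (agree i i<k) (t≈t′ i))) ,
    subst₂ _≺_ (s≈s′ k) (t≈t′ k) s<t

  ≥ω-resp-≈ˢ : ∀ {s s′ t t′} → s ≈ˢ s′ → t ≈ˢ t′ → s ≥ω t → s′ ≥ω t′
  ≥ω-resp-≈ˢ s≈s′ t≈t′ (inj₁ (k , t<s)) = inj₁ (k , <ω[]-resp-≈ˢ t≈t′ s≈s′ t<s)
  ≥ω-resp-≈ˢ s≈s′ t≈t′ (inj₂ s≈t) = inj₂ (≈ˢ-trans (≈ˢ-sym s≈s′) (≈ˢ-trans s≈t t≈t′))

  ≥ω-refl : ∀ {s} → s ≥ω s
  ≥ω-refl = inj₂ (λ _ → refl)

  <ω[]-trans : ∀ {r t s j k} → r <ω[ j ] t → t <ω[ k ] s → ∃[ i ] (i ≤ k × r <ω[ i ] s)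
  <ω[]-trans {r} {t} {s} {j} {k} (r≡t , r<t) (t≡s , t<s) with <-cmp j k
  ... | tri< j<k _ _ =
    j , <⇒≤ j<k , (λ i i<j → trans (r≡t i i<j) (t≡s i (<-trans i<j j<k))) ,
    subst (r j ≺_) (t≡s j j<k) r<t
  ... | tri≈ _ refl _ = k , ≤-refl , (λ i i<k → trans (r≡t i i<k) (t≡s i i<k)) , ≺-trans r<t t<s
  ... | tri> _ _ k<j =
    k , ≤-refl , (λ i i<k → trans (r≡t i (<-trans i<k k<j)) (t≡s i i<k)) ,
    subst (_≺ s k) (sym (r≡t k k<j)) t<s

  ≥ω-<ω[]-trans : ∀ {r t s k} → t ≥ω r → t <ω[ k ] s → ∃[ i ] (i ≤ k × r <ω[ i ] s)
  ≥ω-<ω[]-trans (inj₁ (_ , r<t)) t<s = <ω[]-trans r<t t<s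
  ≥ω-<ω[]-trans {k = k} (inj₂ t≈r) t<s = k , ≤-refl , <ω[]-resp-≈ˢ t≈r (λ _ → refl) t<s

  ≥ω-trans : ∀ {s t r} → s ≥ω t → t ≥ω r → s ≥ω r
  ≥ω-trans (inj₁ (_ , t<s)) t≥r with ≥ω-<ω[]-trans t≥r t<s
  ... | i , _ , r<s = inj₁ (i , r<s)
  ≥ω-trans (inj₂ s≈t) t≥r = ≥ω-resp-≈ˢ (≈ˢ-sym s≈t) (λ _ → refl) t≥r

  <ω[]-transfer : ∀ {r z s k n} → r ≡[< n ] z → k < n → r <ω[ k ] s → z <ω[ k ] s
  <ω[]-transfer {k = k} r≡z k<n (r≡s , r<s) =
    (λ i i<k → trans (sym (r≡z i (<-trans i<k k<n))) (r≡s i i<k)) ,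
    subst (_≺ _) (r≡z k k<n) r<s

  ++ˢ-lookup : ∀ l s i (i<∣l∣ : i < List.length l) → (l ++ˢ s) i ≡ List.lookup l (fromℕ< i<∣l∣)
  ++ˢ-lookup (a ∷ l) s zero    _           = refl
  ++ˢ-lookup (a ∷ l) s (suc i) (s≤s i<∣l∣) = ++ˢ-lookup l s i i<∣l∣

  ≈ˢ-++ˢ : ∀ l {s t} → (∀ i (i<∣l∣ : i < List.length l) → s i ≡ List.lookup l (fromℕ< i<∣l∣)) →
           drop (List.length l) s ≈ˢ t → s ≈ˢ l ++ˢ t
  ≈ˢ-++ˢ []      _    s≈t i       = s≈t i
  ≈ˢ-++ˢ (a ∷ l) head _   zero    = head zero (s≤s z≤n)
  ≈ˢ-++ˢ (a ∷ l) head s≈t (suc i) =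
    ≈ˢ-++ˢ l (λ j j<∣l∣ → head (suc j) (s≤s j<∣l∣)) s≈t i

  ++ˢ-assoc : ∀ l l′ s → l ++ˢ (l′ ++ˢ s) ≈ˢ (l List.++ l′) ++ˢ s
  ++ˢ-assoc []      l′ s i       = refl
  ++ˢ-assoc (a ∷ l) l′ s zero    = refl
  ++ˢ-assoc (a ∷ l) l′ s (suc i) = ++ˢ-assoc l l′ s i

  ++ˢ-cong : ∀ l {s t} → s ≈ˢ t → l ++ˢ s ≈ˢ l ++ˢ t
  ++ˢ-cong []      s≈t i       = s≈t i
  ++ˢ-cong (a ∷ l) s≈t zero    = refl
  ++ˢ-cong (a ∷ l) s≈t (suc i) = ++ˢ-cong l s≈t i

  ++ˢ-cong-≡[<] : ∀ l {s t n} → s ≡[< n ] t → (l ++ˢ s) ≡[< List.length l + n ] (l ++ˢ t)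
  ++ˢ-cong-≡[<] []      s≡t i       i<n       = s≡t i i<n
  ++ˢ-cong-≡[<] (a ∷ l) s≡t zero    _         = refl
  ++ˢ-cong-≡[<] (a ∷ l) s≡t (suc i) (s≤s i<n) = ++ˢ-cong-≡[<] l s≡t i i<n

  ++ˢ-mono-<ω[] : ∀ l {s t k} → s <ω[ k ] t → (l ++ˢ s) <ω[ List.length l + k ] (l ++ˢ t)
  ++ˢ-mono-<ω[] l (s≡t , s<t) = ++ˢ-cong-≡[<] l s≡t , subst₂ _≺_ (sym (shift l)) (sym (shift l)) s<t
    where
      shift : ∀ l {s k} → (l ++ˢ s) (List.length l + k) ≡ s k
      shift []      = refl
      shift (a ∷ l) = shift l

  ++ˢ-mono-≥ω : ∀ l {s t} → s ≥ω t → (l ++ˢ s) ≥ω (l ++ˢ t)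
  ++ˢ-mono-≥ω l (inj₁ (_ , t<s)) = inj₁ (_ , ++ˢ-mono-<ω[] l t<s)
  ++ˢ-mono-≥ω l (inj₂ s≈t)       = inj₂ (++ˢ-cong l s≈t)

  ++ˢ-cancel-<ω[] : ∀ l {s t k} → (l ++ˢ s) <ω[ k ] (l ++ˢ t) →
                    ∃[ k′ ] (List.length l + k′ ≡ k × s <ω[ k′ ] t)
  ++ˢ-cancel-<ω[] []               {k = k}     s<t           = k , refl , s<t
  ++ˢ-cancel-<ω[] (a ∷ l)          {k = zero}  (_ , a<a)     = ⊥-elim (irrefl Eq.refl a<a)
  ++ˢ-cancel-<ω[] (a ∷ l) {s} {t}  {k = suc k} (agree , s<t)
    with ++ˢ-cancel-<ω[] l {s} {t} ((λ i i<k → agree (suc i) (s≤s i<k)) , s<t)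
  ... | k′ , refl , s<t′ = k′ , refl , s<t′

  ^-++ˢ-mono-≥ω : ∀ l x → x ≥ω (l ++ˢ x) → ∀ n → x ≥ω (l ^ n ++ˢ x)
  ^-++ˢ-mono-≥ω l x x≥lx zero    = ≥ω-refl
  ^-++ˢ-mono-≥ω l x x≥lx (suc n) = ≥ω-trans x≥lx (++ˢ-mono-≥ω l (^-++ˢ-mono-≥ω l x x≥lx n))

  ^-++ˢ-fixed : ∀ l x → x ≈ˢ (l ++ˢ x) → ∀ n → x ≈ˢ (l ^ n ++ˢ x)
  ^-++ˢ-fixed l x x≈lx zero    i = refl
  ^-++ˢ-fixed l x x≈lx (suc n)   = ≈ˢ-trans x≈lx (++ˢ-cong l (^-++ˢ-fixed l x x≈lx n))

  ^-++ˢ-≡[<] : ∀ (w : List⁺ A) n s t → (toList w ^ n ++ˢ s) ≡[< n ] (toList w ^ n ++ˢ t)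
  ^-++ˢ-≡[<] w (suc n) s t i (s≤s i≤n) =
    ++ˢ-cong-≡[<] (toList w) (^-++ˢ-≡[<] w n s t) i
      (s≤s (≤-trans i≤n (m≤n+m n (List.length (List⁺.tail w)))))

  ^ω-lookup : ∀ w i (i<∣w∣ : i < List.length (toList w)) → (w ^ω) i ≡ List.lookup (toList w) (fromℕ< i<∣w∣)
  ^ω-lookup w i i<∣w∣ =
    cong (List.lookup (toList w)) (fromℕ<-cong _ _ (m<n⇒m%n≡m i<∣w∣) _ _)

  ^ω-periodic : ∀ w → drop (List.length (toList w)) (w ^ω) ≈ˢ w ^ω
  ^ω-periodic w i = cong (List.lookup (toList w)) (fromℕ<-cong _ _ period _ _)
    where
      n = List.length (toList w)
      period : (n + i) % n ≡ i % n
      period = trans (cong (_% n) (+-comm n i)) ([m+n]%n≡m%n i n)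

  ^ω-unfold : ∀ w → w ^ω ≈ˢ toList w ++ˢ w ^ω
  ^ω-unfold w = ≈ˢ-++ˢ (toList w) (^ω-lookup w) (^ω-periodic w)

  ^ω-unfoldⁿ : ∀ w n → w ^ω ≈ˢ (toList w ^ n ++ˢ w ^ω)
  ^ω-unfoldⁿ w = ^-++ˢ-fixed (toList w) (w ^ω) (^ω-unfold w)

  module _ (v : List⁺ A) where
    private
      l = toList v
      m = List.length l

    ^ω-prefix-split : ∀ x {k} → m ≤ k → v ^ω ≡[< k ] x → x ≈ˢ l ++ˢ drop m x
    ^ω-prefix-split x m≤k v^ω≡x = ≈ˢ-++ˢ l
      (λ i i<m → trans (sym (v^ω≡x i (≤-trans i<m m≤k))) (^ω-lookup v i i<m))
      (λ _ → refl)

    -- If x first differs from v^ω beyond position |v|, then x begins with v;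
    -- strip that copy of v and recurse on the earlier first difference.
    ^ω-<ω[]⇒++ˢ-<ω : ∀ x {k} → Acc _<_ k → v ^ω <ω[ k ] x → (l ++ˢ x) <ω x
    ^ω-<ω[]⇒++ˢ-<ω x {k} (acc smaller) v^ω<x@(v^ω≡x , _) with k <? m
    ... | yes k<m = k , <ω[]-transfer v^ω≡lx k<m v^ω<x
      where
        v^ω≡lx : v ^ω ≡[< m ] (l ++ˢ x)
        v^ω≡lx i i<m = trans (^ω-lookup v i i<m) (sym (++ˢ-lookup l x i i<m))
    ... | no k≮m = strip (^ω-prefix-split x (≮⇒≥ k≮m) v^ω≡x)
      where
        strip : x ≈ˢ l ++ˢ drop m x → (l ++ˢ x) <ω x
        strip x≈lx′ with ++ˢ-cancel-<ω[] l (<ω[]-resp-≈ˢ (^ω-unfold v) x≈lx′ v^ω<x)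
        ... | k′ , m+k′≡k , v^ω<x′
          with ^ω-<ω[]⇒++ˢ-<ω (drop m x) (smaller k′<k) v^ω<x′
          where
            k′<k : k′ < k
            k′<k = subst (k′ <_) m+k′≡k (s≤s (m≤n+m k′ (List.length (List⁺.tail v))))
        ... | j , lx′<x′ =
          m + j , <ω[]-resp-≈ˢ (++ˢ-cong l (≈ˢ-sym x≈lx′)) (≈ˢ-sym x≈lx′) (++ˢ-mono-<ω[] l lx′<x′)

    ≥ω-^ω⇒≥ω-++ˢ : ∀ x → x ≥ω (v ^ω) → x ≥ω (l ++ˢ x)
    ≥ω-^ω⇒≥ω-++ˢ x (inj₁ (k , v^ω<x)) = inj₁ (^ω-<ω[]⇒++ˢ-<ω x (<-wellFounded k) v^ω<x)
    ≥ω-^ω⇒≥ω-++ˢ x (inj₂ x≈v^ω) =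
      inj₂ (≈ˢ-trans x≈v^ω (≈ˢ-trans (^ω-unfold v) (++ˢ-cong l (≈ˢ-sym x≈v^ω))))

  -- x ≥ w x ≥ wᵏ⁺¹ x, and wᵏ⁺¹ x agrees with w^ω on the first k + 1 letters.
  ≥ω-++ˢ⇒≥ω-^ω : ∀ w x → x ≥ω (toList w ++ˢ x) → x ≥ω (w ^ω)
  ≥ω-++ˢ⇒≥ω-^ω w x x≥wx@(inj₁ (k , wx<x))
    with ≥ω-<ω[]-trans (++ˢ-mono-≥ω (toList w) (^-++ˢ-mono-≥ω (toList w) x x≥wx k)) wx<x
  ... | i , i≤k , wᵏ⁺¹x<x =
    inj₁ (i , <ω[]-resp-≈ˢ (≈ˢ-sym (^ω-unfoldⁿ w (suc k))) (λ _ → refl)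
                (<ω[]-transfer (^-++ˢ-≡[<] w (suc k) x (w ^ω)) (s≤s i≤k) wᵏ⁺¹x<x))
  ≥ω-++ˢ⇒≥ω-^ω w x (inj₂ x≈wx) = inj₂ λ i → begin
    x i                                ≡⟨ ^-++ˢ-fixed (toList w) x x≈wx (suc i) i ⟩
    (toList w ^ suc i ++ˢ x) i         ≡⟨ ^-++ˢ-≡[<] w (suc i) x (w ^ω) i ≤-refl ⟩
    (toList w ^ suc i ++ˢ w ^ω) i      ≡⟨ ^ω-unfoldⁿ w (suc i) i ⟨
    (w ^ω) i                           ∎
    where open ≡-Reasoning

  ^ω-≥ω-⁺++-^ω : ∀ u v → (u ^ω) ≥ω (v ^ω) → (u ^ω) ≥ω ((u ⁺++ toList v) ^ω)
  ^ω-≥ω-⁺++-^ω u@(_ List⁺.∷ _) v u≥v =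
    ≥ω-++ˢ⇒≥ω-^ω (u ⁺++ toList v) (u ^ω)
      (≥ω-resp-≈ˢ (≈ˢ-sym (^ω-unfold u)) (++ˢ-assoc (toList u) (toList v) (u ^ω))
        (++ˢ-mono-≥ω (toList u) (≥ω-^ω⇒≥ω-++ˢ v (u ^ω) u≥v)))

  ^ω-≥ω-concat-^ω : ∀ l ls → Linked (λ x y → (x ^ω) ≥ω (y ^ω)) (l ∷ ls) →
                    (l ^ω) ≥ω ((l ⁺++ concat (map toList ls)) ^ω)
  ^ω-≥ω-concat-^ω (h List⁺.∷ t) [] _ =
    subst (λ t′ → ((h List⁺.∷ t) ^ω) ≥ω ((h List⁺.∷ t′) ^ω)) (sym (++-identityʳ t)) ≥ω-refl
  ^ω-≥ω-concat-^ω l (l′@(_ List⁺.∷ _) ∷ ls) (l≥l′ ∷ linked) =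
    ^ω-≥ω-⁺++-^ω l (l′ ⁺++ concat (map toList ls))
      (≥ω-trans l≥l′ (^ω-≥ω-concat-^ω l′ ls linked))

corollary6 : {c ℓ₁ ℓ₂ : Level} (O : StrictTotalOrder c ℓ₁ ℓ₂) →
    let open Words O in
    (l₁ l₂ : List⁺ (StrictTotalOrder.Carrier O)) (rest : List (List⁺ (StrictTotalOrder.Carrier O))) →
    All Lyndon (l₁ ∷ l₂ ∷ rest) →
    Linked (λ x y → (x ^ω) ≥ω (y ^ω)) (l₁ ∷ l₂ ∷ rest) →
    (l₁ ^ω) ≥ω ((l₂ ⁺++ concat (map toList rest)) ^ω)
corollary6 O l₁ l₂ rest _ (l₁≥l₂ ∷ linked) =
  ≥ω-trans l₁≥l₂ (^ω-≥ω-concat-^ω l₂ rest linked)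
  where open LexicographicPowers O
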